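{- Let $r, c, v$ be positive integers such that $e := \frac{rc}{v}$, $\lambda_{rr} := \frac{c(e-1)}{r-1}$, $\lambda_{cc} := \frac{r(e-1)}{c-1}$, $\lambda_{rrc} := \frac{e(e-1)}{r-1}$ and $k := \frac{c}{e}$ are all integers. Let $\mathcal{S}$ be a symmetric 2-$(r, e, \lambda_{rrc})$ design on the point set $\{1, \dots, r\}$ with blocks $S_1, \dots, S_r$, and let $\mathcal{B}$ be a resolution of a 2-$(c, e, \lambda_{cc})$ design with $v$ blocks on the point set $\{1, \dots, c\}$, with parallel classes $\mathcal{B}_1, \dots, \mathcal{B}_r$, where $\mathcal{B}_x = \{B_{x1}, \dots, B_{xk}\}$. Treating the $v$ blocks $B_{xy}$ as (distinct) symbols, define \[ R_i := \bigcup_{x\,:\,i \in S_x} \mathcal{B}_x \quad (1 \le i \le r),\qquad C_j := \{ B_{xy} : j \in B_{xy} \} \quad (1 \le j \le c). \] Then the sets $R_1, \dots, R_r$ (as row-sets) and $C_1, \dots, C_c$ (as column-sets) form an $(r \times c, v)$-unordered triple array.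
   Context: A 2-$(n,k,\lambda)$ design is a collection (multiset) of $k$-subsets (blocks) of an $n$-element point set such that every pair of distinct points lies in exactly $\lambda$ blocks; it is symmetric if it has exactly $n$ blocks. A parallel class is a set of blocks partitioning the point set; a resolution is a partition of the collection of blocks into parallel classes. An $(r \times c, v)$-unordered triple array on a set $V$ of $v$ symbols is a collection of $c$-subsets $R_1, \dots, R_r \subseteq V$ (row-sets) and $r$-subsets $C_1, \dots, C_c \subseteq V$ (column-sets) such that, for some integers $e, \lambda_{rc}, \lambda_{rr}, \lambda_{cc}$, each symbol lies in exactly $e$ row-sets and exactly $e$ column-sets, $|R_i \cap C_j| = \lambda_{rc}$ for all $i,j$, $|R_i \cap R_s| = \lambda_{rr}$ for all $i \neq s$, and $|C_j \cap C_t| = \lambda_{cc}$ for all $j \neq t$. -}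

module Defs where

open import Data.Nat using (ℕ; _*_)
open import Data.Bool using (Bool; _∧_)
open import Data.Fin using (Fin; cast; remQuot)
open import Data.Fin.Subset using (Subset; ∣_∣; _∩_)
open import Data.Vec using (lookup; tabulate)
open import Data.Product using (_×_; _,_; proj₁; proj₂; uncurry)
open import Relation.Binary.PropositionalEquality using (_≡_; sym)
open import Relation.Nullary using (¬_)

count : ∀ {m} → (Fin m → Bool) → ℕ
count p = ∣ tabulate p ∣

-- A 2-(n, κ, λ) design on the point set Fin n whose b blocks are given as
-- an indexed family (so repeated blocks = multiset are allowed).
record Is2Design (n κ λ′ : ℕ) {b : ℕ} (B : Fin b → Subset n) : Set where
  field
    blockSize : ∀ β → ∣ B β ∣ ≡ κ
    pairCount : ∀ p q → ¬ p ≡ q →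
                count (λ β → lookup (B β) p ∧ lookup (B β) q) ≡ λ′

IsParallelClass : ∀ {n k} → (Fin k → Subset n) → Set
IsParallelClass {n} P = ∀ (p : Fin n) → count (λ y → lookup (P y) p) ≡ 1

allBlocks : ∀ {r k c} → (Fin r → Fin k → Subset c) → Fin (r * k) → Subset c
allBlocks {k = k} B β = uncurry B (remQuot k β)

record IsUTA (r c v : ℕ) (R : Fin r → Subset v) (C : Fin c → Subset v) : Set where
  field
    e λrc λrr λcc : ℕ
    rowSize  : ∀ i → ∣ R i ∣ ≡ c
    colSize  : ∀ j → ∣ C j ∣ ≡ r
    rowRep   : ∀ s → count (λ i → lookup (R i) s) ≡ e
    colRep   : ∀ s → count (λ j → lookup (C j) s) ≡ e
    rowCol   : ∀ i j → ∣ R i ∩ C j ∣ ≡ λrc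
    rowRow   : ∀ i s → ¬ i ≡ s → ∣ R i ∩ R s ∣ ≡ λrr
    colCol   : ∀ j t → ¬ j ≡ t → ∣ C j ∩ C t ∣ ≡ λcc

-- Symbols: symbol s : Fin v corresponds to the block B_xy with (x , y) = decode s,
-- via the bijection Fin v ≅ Fin (r * k) ≅ Fin r × Fin k.
decode : ∀ {r k v} → r * k ≡ v → Fin v → Fin r × Fin k
decode {k = k} eq s = remQuot k (cast (sym eq) s)

rowSets : ∀ {r k v} → (Fin r → Subset r) → r * k ≡ v → Fin r → Subset v
rowSets {r} {k} S eq i = tabulate (λ s → lookup (S (proj₁ (decode {r} {k} eq s))) i)

colSets : ∀ {r k c v} → (Fin r → Fin k → Subset c) → r * k ≡ v → Fin c → Subset v
colSets {r} {k} B eq j = tabulate (λ s → lookup (uncurry B (decode {r} {k} eq s)) j)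

{-# OPTIONS --safe #-}
-- Identify the symbol B_xy with the pair (x , y).  The number of row-sets (column-sets)
-- containing B_xy is then |S_x| (|B_xy|), and the size of a row-set, a column-set or an
-- intersection of two of them is a double sum over x and y.  The sum over y is either
-- constant (row-sets depend on x only) or collapses to a single term (𝓑_x is a parallel
-- class), so it reduces to a pair count of 𝒮 or 𝓑, or to a replication number of 𝒮.
-- The latter equals e, because double counting gives R (e - 1) = λrrc (r - 1) = e (e - 1)
-- for the replication number R.
module Submission where

open import Defs
open import Data.Nat using (ℕ; zero; suc; _+_; _*_; _∸_; _≤_; s≤s; z≤n)
open import Data.Nat.Properties
  using (+-*-semiring; +-assoc; *-comm; *-identityˡ; *-identityʳ;
         *-cancelʳ-≡; *-distribˡ-∸; m+n∸m≡n)
open import Data.Bool using (Bool; true; false; _∧_)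
open import Data.Bool.Properties using (∧-idem)
open import Data.Fin using (Fin; zero; suc; _↑ˡ_; _↑ʳ_; combine; remQuot; punchIn; cast)
open import Data.Fin.Properties using (remQuot-combine; punchInᵢ≢i; cast-is-id)
open import Data.Fin.Subset using (Subset; ∣_∣; _∩_)
open import Data.Vec using (_∷_; lookup; tabulate)
open import Data.Vec.Properties using (lookup∘tabulate; tabulate∘lookup; tabulate-cong)
open import Data.Product using (_×_; _,_; proj₁; uncurry)
open import Function using (_∘_)
open import Relation.Binary.PropositionalEquality
  using (_≡_; refl; sym; trans; cong; cong₂; module ≡-Reasoning)
open import Algebra.Properties.Semiring.Sum +-*-semiring
  using (sum-syntax; ∑-comm; sum-cong-≗; sum-remove; sum-replicate-zero;
         *-distribˡ-sum; *-distribʳ-sum)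

open ≡-Reasoning

𝟙 : Bool → ℕ
𝟙 true  = 1
𝟙 false = 0

∑-const : ∀ n a → ∑[ i < n ] a ≡ n * a
∑-const zero    a = refl
∑-const (suc n) a = cong (a +_) (∑-const n a)

∑-∧ˡ : ∀ {n} a (p : Fin n → Bool) → ∑[ i < n ] 𝟙 (a ∧ p i) ≡ 𝟙 a * ∑[ i < n ] 𝟙 (p i)
∑-∧ˡ     true  p = sym (*-identityˡ _)
∑-∧ˡ {n} false p = sum-replicate-zero n

∑-↑ : ∀ m {n} (f : Fin (m + n) → ℕ) →
      ∑[ i < m + n ] f i ≡ ∑[ i < m ] f (i ↑ˡ n) + ∑[ j < n ] f (m ↑ʳ j)
∑-↑ zero    f = refl
∑-↑ (suc m) f = trans (cong (f zero +_) (∑-↑ m (f ∘ suc))) (sym (+-assoc (f zero) _ _))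

∑-combine : ∀ m n (f : Fin (m * n) → ℕ) →
            ∑[ i < m * n ] f i ≡ ∑[ x < m ] ∑[ y < n ] f (combine x y)
∑-combine zero    n f = refl
∑-combine (suc m) n f =
  trans (∑-↑ n f) (cong (∑[ y < n ] f (y ↑ˡ (m * n)) +_) (∑-combine m n (f ∘ (n ↑ʳ_))))

∑-remQuot : ∀ m n (g : Fin m × Fin n → ℕ) →
            ∑[ i < m * n ] g (remQuot n i) ≡ ∑[ x < m ] ∑[ y < n ] g (x , y)
∑-remQuot m n g =
  trans (∑-combine m n _) (sum-cong-≗ λ x → sum-cong-≗ λ y → cong g (remQuot-combine x y))

count≡∑𝟙 : ∀ {m} (p : Fin m → Bool) → count p ≡ ∑[ i < m ] 𝟙 (p i)
count≡∑𝟙 {zero}  p = refl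
count≡∑𝟙 {suc m} p with p zero
... | true  = cong suc (count≡∑𝟙 (p ∘ suc))
... | false = count≡∑𝟙 (p ∘ suc)

count-cong : ∀ {m} {p q : Fin m → Bool} → (∀ i → p i ≡ q i) → count p ≡ count q
count-cong p≗q = cong ∣_∣ (tabulate-cong p≗q)

count-true : ∀ n → count {n} (λ _ → true) ≡ n
count-true zero    = refl
count-true (suc n) = cong suc (count-true n)

count-lookup : ∀ {m} (P : Subset m) → count (lookup P) ≡ ∣ P ∣
count-lookup P = cong ∣_∣ (tabulate∘lookup P)

count-remQuot : ∀ {m n} (P : Fin m × Fin n → Bool) →
                count (P ∘ remQuot n) ≡ ∑[ x < m ] ∑[ y < n ] 𝟙 (P (x , y))
count-remQuot {m} {n} P = trans (count≡∑𝟙 (P ∘ remQuot n)) (∑-remQuot m n (𝟙 ∘ P))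

∩-tabulate : ∀ {m} (p q : Fin m → Bool) → tabulate p ∩ tabulate q ≡ tabulate (λ i → p i ∧ q i)
∩-tabulate {zero}  p q = refl
∩-tabulate {suc m} p q = cong (p zero ∧ q zero ∷_) (∩-tabulate (p ∘ suc) (q ∘ suc))

replication : ∀ {n b} → (Fin b → Subset n) → Fin n → ℕ
replication B i = count (λ β → lookup (B β) i)

transpose : ∀ {m n} → (Fin n → Subset m) → Fin m → Subset n
transpose F i = tabulate (λ s → lookup (F s) i)

replication-transpose : ∀ {m n} (F : Fin n → Subset m) s → replication (transpose F) s ≡ ∣ F s ∣
replication-transpose F s =
  trans (count-cong (λ i → lookup∘tabulate (λ s′ → lookup (F s′) i) s)) (count-lookup (F s))

∣transpose∩transpose∣ : ∀ {m m′ n} (F : Fin n → Subset m) (G : Fin n → Subset m′) i j →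
                        ∣ transpose F i ∩ transpose G j ∣ ≡ count (λ s → lookup (F s) i ∧ lookup (G s) j)
∣transpose∩transpose∣ F G i j = cong ∣_∣ (∩-tabulate (λ s → lookup (F s) i) (λ s → lookup (G s) j))

replication*[κ∸1]≡[n∸1]*λ : ∀ {n κ λ′ b} {B : Fin b → Subset n} → Is2Design n κ λ′ B →
                            ∀ i → replication B i * (κ ∸ 1) ≡ (n ∸ 1) * λ′
replication*[κ∸1]≡[n∸1]*λ {suc n} {κ} {λ′} {b} {B} D i = begin
  R * (κ ∸ 1)          ≡⟨ *-distribˡ-∸ R κ 1 ⟩
  R * κ ∸ R * 1        ≡⟨ cong₂ _∸_ doubleCount (*-identityʳ R) ⟩
  R + n * λ′ ∸ R       ≡⟨ m+n∸m≡n R (n * λ′) ⟩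
  n * λ′               ∎
  where
  open Is2Design D
  incident : Fin b → Fin (suc n) → Bool
  incident β p = lookup (B β) p

  R = replication B i
  pairs : Fin (suc n) → ℕ
  pairs p = ∑[ β < b ] 𝟙 (incident β i ∧ incident β p)

  pairs-i : pairs i ≡ R
  pairs-i = trans (sum-cong-≗ λ β → cong 𝟙 (∧-idem (incident β i))) (sym (count≡∑𝟙 (λ β → incident β i)))

  pairs-punchIn : ∀ j → pairs (punchIn i j) ≡ λ′
  pairs-punchIn j = trans (sym (count≡∑𝟙 (λ β → incident β i ∧ incident β (punchIn i j))))
                          (pairCount i _ (punchInᵢ≢i i j ∘ sym))

  size : ∀ β → ∑[ p < suc n ] 𝟙 (incident β p) ≡ κ
  size β = trans (sym (count≡∑𝟙 (incident β))) (trans (count-lookup (B β)) (blockSize β))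

  doubleCount : R * κ ≡ R + n * λ′
  doubleCount = begin
    R * κ                                         ≡⟨ cong (_* κ) (count≡∑𝟙 (λ β → incident β i)) ⟩
    (∑[ β < b ] 𝟙 (incident β i)) * κ             ≡⟨ *-distribʳ-sum κ (λ β → 𝟙 (incident β i)) ⟩
    ∑[ β < b ] (𝟙 (incident β i) * κ)             ≡⟨ sum-cong-≗ (λ β → cong (𝟙 (incident β i) *_) (size β)) ⟨
    ∑[ β < b ] (𝟙 (incident β i) * ∑[ p < suc n ] 𝟙 (incident β p))
                                                  ≡⟨ sum-cong-≗ (λ β → ∑-∧ˡ (incident β i) (incident β)) ⟨
    ∑[ β < b ] ∑[ p < suc n ] 𝟙 (incident β i ∧ incident β p)
                                                  ≡⟨ ∑-comm (λ β p → 𝟙 (incident β i ∧ incident β p)) ⟩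
    ∑[ p < suc n ] pairs p                        ≡⟨ sum-remove {i = i} pairs ⟩
    pairs i + ∑[ j < n ] pairs (punchIn i j)      ≡⟨ cong₂ _+_ pairs-i (sum-cong-≗ pairs-punchIn) ⟩
    R + ∑[ j < n ] λ′                             ≡⟨ cong (R +_) (∑-const n λ′) ⟩
    R + n * λ′                                    ∎

replication≡blockSize : ∀ {n κ λ′ b} {B : Fin b → Subset n} → Is2Design n κ λ′ B →
                        2 ≤ κ → λ′ * (n ∸ 1) ≡ κ * (κ ∸ 1) → ∀ i → replication B i ≡ κ
replication≡blockSize {n} {κ@(suc (suc _))} {λ′} {B = B} D (s≤s (s≤s z≤n)) λ[n∸1]≡κ[κ∸1] i =
  *-cancelʳ-≡ _ κ (κ ∸ 1) (begin
    replication B i * (κ ∸ 1)  ≡⟨ replication*[κ∸1]≡[n∸1]*λ D i ⟩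
    (n ∸ 1) * λ′               ≡⟨ *-comm (n ∸ 1) λ′ ⟩
    λ′ * (n ∸ 1)               ≡⟨ λ[n∸1]≡κ[κ∸1] ⟩
    κ * (κ ∸ 1)                ∎)

count-decode : ∀ {r k v} (eq : r * k ≡ v) (P : Fin r × Fin k → Bool) →
               count (P ∘ decode eq) ≡ ∑[ x < r ] ∑[ y < k ] 𝟙 (P (x , y))
count-decode {k = k} refl P =
  trans (count-cong (λ s → cong (P ∘ remQuot k) (cast-is-id refl s))) (count-remQuot P)

module _ {r k v} (eq : r * k ≡ v) where

  count-decode-proj₁ : (p : Fin r → Bool) → count (p ∘ proj₁ ∘ decode eq) ≡ k * count p
  count-decode-proj₁ p = begin
    count (p ∘ proj₁ ∘ decode eq)        ≡⟨ count-decode eq (p ∘ proj₁) ⟩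
    ∑[ x < r ] ∑[ y < k ] 𝟙 (p x)        ≡⟨ sum-cong-≗ (λ x → ∑-const k (𝟙 (p x))) ⟩
    ∑[ x < r ] (k * 𝟙 (p x))             ≡⟨ *-distribˡ-sum k (𝟙 ∘ p) ⟨
    k * ∑[ x < r ] 𝟙 (p x)               ≡⟨ cong (k *_) (count≡∑𝟙 p) ⟨
    k * count p                          ∎

  count-decode-∧-unique : (p : Fin r → Bool) (q : Fin r → Fin k → Bool) → (∀ x → count (q x) ≡ 1) →
                          count (λ s → p (proj₁ (decode eq s)) ∧ uncurry q (decode eq s)) ≡ count p
  count-decode-∧-unique p q unique = begin
    count (λ s → p (proj₁ (decode eq s)) ∧ uncurry q (decode eq s))
                                                 ≡⟨ count-decode eq (λ d → p (proj₁ d) ∧ uncurry q d) ⟩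
    ∑[ x < r ] ∑[ y < k ] 𝟙 (p x ∧ q x y)        ≡⟨ sum-cong-≗ (λ x → ∑-∧ˡ (p x) (q x)) ⟩
    ∑[ x < r ] (𝟙 (p x) * ∑[ y < k ] 𝟙 (q x y))  ≡⟨ sum-cong-≗ (λ x → cong (𝟙 (p x) *_) (one x)) ⟩
    ∑[ x < r ] (𝟙 (p x) * 1)                     ≡⟨ sum-cong-≗ (λ x → *-identityʳ (𝟙 (p x))) ⟩
    ∑[ x < r ] 𝟙 (p x)                           ≡⟨ count≡∑𝟙 p ⟨
    count p                                      ∎
    where
    one : ∀ x → ∑[ y < k ] 𝟙 (q x y) ≡ 1
    one x = trans (sym (count≡∑𝟙 (q x))) (unique x)

  module _ (S : Fin r → Subset r) where

    ∣rowSets∣ : ∀ i → ∣ rowSets S eq i ∣ ≡ k * replication S i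
    ∣rowSets∣ i = count-decode-proj₁ (λ x → lookup (S x) i)

    ∣rowSets∩rowSets∣ : ∀ i s → ∣ rowSets S eq i ∩ rowSets S eq s ∣ ≡
                                k * count (λ x → lookup (S x) i ∧ lookup (S x) s)
    ∣rowSets∩rowSets∣ i s =
      trans (∣transpose∩transpose∣ (S ∘ proj₁ ∘ decode eq) (S ∘ proj₁ ∘ decode eq) i s)
            (count-decode-proj₁ (λ x → lookup (S x) i ∧ lookup (S x) s))

  module _ {c} (B : Fin r → Fin k → Subset c) (parallel : ∀ x → IsParallelClass (B x)) where

    ∣colSets∣ : ∀ j → ∣ colSets B eq j ∣ ≡ r
    ∣colSets∣ j =
      trans (count-decode-∧-unique (λ _ → true) (λ x y → lookup (B x y) j) (λ x → parallel x j))
            (count-true r)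

    ∣rowSets∩colSets∣ : ∀ (S : Fin r → Subset r) i j →
                        ∣ rowSets S eq i ∩ colSets B eq j ∣ ≡ replication S i
    ∣rowSets∩colSets∣ S i j =
      trans (∣transpose∩transpose∣ (S ∘ proj₁ ∘ decode eq) (uncurry B ∘ decode eq) i j)
            (count-decode-∧-unique (λ x → lookup (S x) i) (λ x y → lookup (B x y) j) (λ x → parallel x j))

  ∣colSets∩colSets∣ : ∀ {c} (B : Fin r → Fin k → Subset c) j t →
                      ∣ colSets B eq j ∩ colSets B eq t ∣ ≡
                      count (λ β → lookup (allBlocks B β) j ∧ lookup (allBlocks B β) t)
  ∣colSets∩colSets∣ B j t =
    trans (∣transpose∩transpose∣ (uncurry B ∘ decode eq) (uncurry B ∘ decode eq) j t)
          (trans (count-decode eq P) (sym (count-remQuot P)))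
    where
    P : Fin r × Fin k → Bool
    P d = lookup (uncurry B d) j ∧ lookup (uncurry B d) t

proposition2 : (r c v e λrr λcc λrrc k : ℕ) →
    1 ≤ r → 1 ≤ c → 1 ≤ v →
    e * v ≡ r * c →
    λrr * (r ∸ 1) ≡ c * (e ∸ 1) →
    λcc * (c ∸ 1) ≡ r * (e ∸ 1) →
    λrrc * (r ∸ 1) ≡ e * (e ∸ 1) →
    k * e ≡ c →
    2 ≤ e →
    (S : Fin r → Subset r) → Is2Design r e λrrc S →
    (B : Fin r → Fin k → Subset c) → (eq : r * k ≡ v) →
    Is2Design c e λcc (allBlocks B) →
    (∀ x → IsParallelClass (B x)) →
    IsUTA r c v (rowSets S eq) (colSets B eq)
-- The array's λrr is k * λrrc.
proposition2 r c v e λrr λcc λrrc k _ _ _ _ _ _ λrrc[r∸1]≡e[e∸1] k*e≡c 2≤e S 𝒮 B eq 𝓑 parallel = record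
  { e       = e
  ; λrc     = e
  ; λrr     = k * λrrc
  ; λcc     = λcc
  ; rowSize = λ i → trans (∣rowSets∣ eq S i) (trans (cong (k *_) (replicationS≡e i)) k*e≡c)
  ; colSize = ∣colSets∣ eq B parallel
  ; rowRep  = λ s → trans (replication-transpose (S ∘ proj₁ ∘ decode eq) s) (𝒮.blockSize _)
  ; colRep  = λ s → trans (replication-transpose (uncurry B ∘ decode eq) s)
                          (𝓑.blockSize (cast (sym eq) s))
  ; rowCol  = λ i j → trans (∣rowSets∩colSets∣ eq B parallel S i j) (replicationS≡e i)
  ; rowRow  = λ i s i≢s → trans (∣rowSets∩rowSets∣ eq S i s) (cong (k *_) (𝒮.pairCount i s i≢s))
  ; colCol  = λ j t j≢t → trans (∣colSets∩colSets∣ eq B j t) (𝓑.pairCount j t j≢t)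
  }
  where
  module 𝒮 = Is2Design 𝒮
  module 𝓑 = Is2Design 𝓑
  replicationS≡e : ∀ i → replication S i ≡ e
  replicationS≡e = replication≡blockSize 𝒮 2≤e λrrc[r∸1]≡e[e∸1]
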